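{- Let $A$ be a set with $|A| = k$, $B$ a nonempty set, $n\geq 1$, let $f^*, g^* \colon \mathcal{Z}^{(n)}(A) \to B$, let $f = f^*\circ\mathrm{cs}|_{A^n}$ and $g = g^*\circ\mathrm{cs}|_{A^n}$, and let $\sigma \in S_n$. Then: (i) $g(\mathbf{b}) = f(\mathbf{b}\sigma)$ for all $\mathbf{b}\in A^n$ if and only if for every $\ell \in Z(k,n)$ and every $\tau \in \mathrm{Pat}^{(\ell)}\sigma$, $g^*(M,\mathbf{a}) = f^*(M,\mathbf{a}\tau)$ for all $(M,\mathbf{a}) \in \mathcal{Z}^{(n)}_\ell(A)$; (ii) $\sigma \in \mathrm{Inv} f$ if and only if $\mathrm{Pat}^{(\ell)}\sigma \subseteq \mathrm{Inv} f^*_\ell$ for every $\ell \in Z(k,n)$; (iii) $\mathrm{Inv} f = \bigcap_{\ell\in Z(k,n)} \mathrm{Comp}^{(n)} \mathrm{Inv} f^*_\ell$.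
   Context: For $\mathbf{a}\in A^m$ and $\tau\colon\{1,\dots,p\}\to\{1,\dots,m\}$, $\mathbf{a}\tau := (a_{\tau(1)},\dots,a_{\tau(p)})$. The content $\mathrm{ms}(\mathbf{a})$ is the multiset of entries of $\mathbf{a}$; a singleton of $\mathbf{a}$ is an element occurring exactly once; $\mathrm{singles}(\mathbf{a})$ lists the singletons in order of occurrence; $\mathrm{cs}(\mathbf{a}) := (\mathrm{ms}(\mathbf{a}),\mathrm{singles}(\mathbf{a}))$. $\mathcal{Z}^{(n)}(A)$ is the set of pairs $(M,\mathbf{a})$ with $M$ a finite multiset over $A$ of cardinality $n$ (sum of multiplicities), $\mathbf{a}$ a tuple over $A$ without repeated entries, and for all $a\in A$: $a$ occurs in $\mathbf{a}$ iff $a$ has multiplicity $1$ in $M$ (this is exactly the image $\mathrm{cs}(A^n)$); $\mathcal{Z}^{(n)}_\ell(A)$ is its subset of pairs with $|\mathbf{a}| = \ell$. $Z(k,n) := \{0,1,\dots,k-1\}$ if $k<n$ and $Z(k,n):=\{0,1,\dots,n\}\setminus\{n-1\}$ if $k\geq n$. $f^*_\ell$ is the restriction of $f^*$ to $\mathcal{Z}^{(n)}_\ell(A)$, and $\mathrm{Inv} f^*_\ell := \{\tau\in S_\ell : f^*(M,\mathbf{a}) = f^*(M,\mathbf{a}\tau) \text{ for all } (M,\mathbf{a})\in\mathcal{Z}^{(n)}_\ell(A)\}$ ($S_0$ is the trivial group). $\mathrm{Inv} f := \{\sigma\in S_n : f(\mathbf{a}\sigma) = f(\mathbf{a})\ \forall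 \mathbf{a}\in A^n\}$. Patterns: for $S\subseteq\{1,\dots,n\}$, $|S|=\ell$, $h_S\colon\{1,\dots,\ell\}\to S$ is the order-isomorphism and $\sigma_S := h_{\sigma(S)}^{ -1}\circ\sigma|_S\circ h_S\in S_\ell$; $\mathrm{Pat}^{(\ell)}\sigma := \{\sigma_S : S\subseteq\{1,\dots,n\}, |S|=\ell\}$; for $G\subseteq S_\ell$, $\mathrm{Comp}^{(n)} G := \{\pi\in S_n : \mathrm{Pat}^{(\ell)}\pi\subseteq G\}$. -}

module Defs where

open import Data.Nat as ℕ using (ℕ; zero; suc; _<_; _≤_; _∸_)
open import Data.Fin as Fin using (Fin)
open import Data.Fin.Properties using (_≟_)
open import Data.Fin.Permutation using (Permutation′; _⟨$⟩ʳ_)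
open import Data.Vec as Vec using (Vec; tabulate; lookup; toList)
open import Data.List as List using (List)
open import Data.List.Membership.Propositional using (_∈_)
open import Data.List.Relation.Unary.Unique.Propositional using (Unique)
open import Data.Product using (Σ; Σ-syntax; _×_)
open import Data.Sum using (_⊎_)
open import Relation.Binary.PropositionalEquality using (_≡_; _≢_)
open import Relation.Nullary using (¬_)

-- The alphabet A with |A| = k is Fin k.
-- A finite multiset over Fin k is its multiplicity vector (Vec ℕ k).

_∙_ : ∀ {A : Set} {m} → Vec A m → Permutation′ m → Vec A m
a ∙ τ = tabulate (λ i → lookup a (τ ⟨$⟩ʳ i))

ms : ∀ {k n} → Vec (Fin k) n → Vec ℕ k
ms a = tabulate (λ x → Vec.count (_≟ x) a)

singles : ∀ {k n} → Vec (Fin k) n → List (Fin k)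
singles a = List.filter (λ x → Vec.count (_≟ x) a ℕ.≟ 1) (toList a)

IsZ : ∀ {k} (n : ℕ) → Vec ℕ k → List (Fin k) → Set
IsZ {k} n M a =
  Vec.sum M ≡ n × Unique a ×
  ((x : Fin k) → (x ∈ a → lookup M x ≡ 1) × (lookup M x ≡ 1 → x ∈ a))

InZ : ℕ → ℕ → ℕ → Set
InZ k n ℓ = (k < n × ℓ < k) ⊎ (n ≤ k × ℓ ≤ n × ℓ ≢ n ∸ 1)

_∘cs : ∀ {k n} {B : Set} → (Vec ℕ k → List (Fin k) → B) → Vec (Fin k) n → B
(F ∘cs) b = F (ms b) (singles b)

Inv : ∀ {k n} {B : Set} → (Vec (Fin k) n → B) → Permutation′ n → Set
Inv {k} {n} f σ = (b : Vec (Fin k) n) → f (b ∙ σ) ≡ f b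

InvStar : ∀ {k} {B : Set} (n ℓ : ℕ) → (Vec ℕ k → List (Fin k) → B) → Permutation′ ℓ → Set
InvStar {k} n ℓ F τ =
  (M : Vec ℕ k) (a : Vec (Fin k) ℓ) → IsZ n M (toList a) →
  F M (toList a) ≡ F M (toList (a ∙ τ))

StrictlyIncreasing : ∀ {ℓ n} → (Fin ℓ → Fin n) → Set
StrictlyIncreasing h = ∀ i j → i Fin.< j → h i Fin.< h j

-- τ ∈ Pat^(ℓ) σ : there is an ℓ-subset S of {1..n}, given by its order
-- isomorphism h = h_S, with h' = h_{σ(S)} and h_{σ(S)} ∘ σ_S = σ ∘ h_S, τ = σ_S.
IsPattern : ∀ {n ℓ} → Permutation′ n → Permutation′ ℓ → Set
IsPattern {n} {ℓ} σ τ =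
  Σ[ h ∈ (Fin ℓ → Fin n) ] Σ[ h′ ∈ (Fin ℓ → Fin n) ]
    StrictlyIncreasing h × StrictlyIncreasing h′ ×
    (∀ i → σ ⟨$⟩ʳ h i ≡ h′ (τ ⟨$⟩ʳ i))

Comp : ∀ {ℓ} (n : ℕ) → (Permutation′ ℓ → Set) → Permutation′ n → Set
Comp {ℓ} n G π = (τ : Permutation′ ℓ) → IsPattern π τ → G τ

module Submission where

-- Permuting b permutes positions only: ms (b σ) = ms b, and the singleton positions of b σ are
-- the σ-preimages of those of b.  Listing both position sets in increasing order, σ restricted to
-- them is a pattern τ of σ, and singles (b σ) = (singles b) τ.  So g (b) = f (b σ) is the patterned
-- identity at (ms b, singles b), whose number of singletons always lies in Z(k,n).  Conversely every
-- (M , a) in 𝒵_ℓ, placed at any ℓ positions, is cs of some b: put a there and fill the other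
-- positions with the letters of multiplicity ≠ 1.  Parts (ii) and (iii) are part (i) with g = f.

open import Defs
open import Data.Nat as ℕ using (ℕ; zero; suc; _+_; _≤_; _<_; _∸_; s≤s)
import Data.Nat.Properties as ℕP
open import Data.Fin as Fin using (Fin; zero; suc; _↑ˡ_)
import Data.Fin.Properties as FinP
open import Data.Fin.Properties using (_≟_)
open import Data.Fin.Permutation as Perm
  using (Permutation; Permutation′; _⟨$⟩ʳ_; _⟨$⟩ˡ_; inverseˡ; inverseʳ; permutation; ↔⇒≡; _∘ₚ_; transpose)
import Data.Fin.Permutation.Components as PC
open import Data.Vec as Vec using (Vec; []; _∷_; tabulate; lookup; toList; _++_)
import Data.Vec.Properties as VecP
open import Data.List as List using (List; []; _∷_)
import Data.List.Properties as ListP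
open import Data.List.Membership.Propositional using (_∈_; _∉_)
open import Data.List.Membership.Propositional.Properties
  using (∈-filter⁺; ∈-filter⁻; ∈-tabulate⁺; ∈-tabulate⁻; ∈-allFin; ∈-lookup)
open import Data.List.Relation.Unary.Any as Any using (here; there)
import Data.List.Relation.Unary.Any.Properties as AnyP
import Data.List.Relation.Unary.All as All
open import Data.List.Relation.Unary.AllPairs using (AllPairs; []; _∷_)
import Data.List.Relation.Unary.AllPairs.Properties as AllPairsP
open import Data.List.Relation.Unary.Unique.Propositional using (Unique)
import Data.List.Relation.Unary.Unique.Propositional.Properties as UniqueP
open import Data.Product using (Σ-syntax; ∃; _×_; _,_; proj₁; proj₂; swap)
open import Data.Sum using (inj₁; inj₂)
open import Data.Empty using (⊥-elim)
open import Function using (_∘_; id)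
open import Function.Definitions using (Injective)
open import Function.Bundles using (_⇔_; mk⇔)
open import Relation.Binary.PropositionalEquality
open import Relation.Nullary using (¬_; Dec; yes; no)
open import Relation.Unary using (Pred; Decidable; _≐_)
open import Relation.Binary.Core using (Rel)
open import Relation.Binary.Definitions using (Asymmetric; tri<; tri≈; tri>)
open import Level using (0ℓ)
open import Algebra.Properties.CommutativeMonoid.Sum ℕP.+-0-commutativeMonoid
  using (sum; sum-cong-≗; sum-permute; ∑-comm)

indicator : ∀ {p} {P : Set p} → Dec P → ℕ
indicator (yes _) = 1
indicator (no _)  = 0

indicator-yes : ∀ {p} {P : Set p} (d : Dec P) → P → indicator d ≡ 1
indicator-yes (yes _) _  = refl
indicator-yes (no ¬p) p  = ⊥-elim (¬p p)

indicator-no : ∀ {p} {P : Set p} (d : Dec P) → ¬ P → indicator d ≡ 0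
indicator-no (yes p) ¬p = ⊥-elim (¬p p)
indicator-no (no _)  _  = refl

count≡∑indicator : ∀ {A : Set} {p} {P : Pred A p} (P? : Decidable P) {n} (v : Vec A n) →
  Vec.count P? v ≡ sum (λ i → indicator (P? (lookup v i)))
count≡∑indicator P? []      = refl
count≡∑indicator P? (x ∷ v) with P? x
... | yes _ = cong suc (count≡∑indicator P? v)
... | no _  = count≡∑indicator P? v

count-∙ : ∀ {A : Set} {p} {P : Pred A p} (P? : Decidable P) {n} (v : Vec A n) (σ : Permutation′ n) →
  Vec.count P? (v ∙ σ) ≡ Vec.count P? v
count-∙ P? {n} v σ = begin
  Vec.count P? (v ∙ σ)                             ≡⟨ count≡∑indicator P? (v ∙ σ) ⟩
  sum (λ i → indicator (P? (lookup (v ∙ σ) i)))    ≡⟨ sum-cong-≗ {n} (cong (indicator ∘ P?) ∘ VecP.lookup∘tabulate _) ⟩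
  sum (λ i → indicator (P? (lookup v (σ ⟨$⟩ʳ i)))) ≡⟨ sum-permute (λ i → indicator (P? (lookup v i))) σ ⟨
  sum (λ i → indicator (P? (lookup v i)))          ≡⟨ count≡∑indicator P? v ⟨
  Vec.count P? v                                   ∎
  where open ≡-Reasoning

count-++ : ∀ {A : Set} {p} {P : Pred A p} (P? : Decidable P) {m n} (xs : Vec A m) (ys : Vec A n) →
  Vec.count P? (xs ++ ys) ≡ Vec.count P? xs + Vec.count P? ys
count-++ P? []       ys = refl
count-++ P? (x ∷ xs) ys with P? x
... | yes _ = cong suc (count-++ P? xs ys)
... | no _  = count-++ P? xs ys

∑-zero : ∀ {n} (f : Fin n → ℕ) → (∀ i → f i ≡ 0) → sum f ≡ 0
∑-zero {zero}  f f≡0 = refl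
∑-zero {suc n} f f≡0 = cong₂ _+_ (f≡0 zero) (∑-zero (f ∘ suc) (f≡0 ∘ suc))

∑-one : ∀ {n} (f : Fin n → ℕ) → (∀ i → f i ≡ 1) → sum f ≡ n
∑-one {zero}  f f≡1 = refl
∑-one {suc n} f f≡1 = cong₂ _+_ (f≡1 zero) (∑-one (f ∘ suc) (f≡1 ∘ suc))

∑-delta : ∀ {n} (f : Fin n → ℕ) (y : Fin n) → f y ≡ 1 → (∀ x → x ≢ y → f x ≡ 0) → sum f ≡ 1
∑-delta f zero    fy≡1 f≡0 = cong₂ _+_ fy≡1 (∑-zero (f ∘ suc) (λ i → f≡0 (suc i) λ ()))
∑-delta f (suc y) fy≡1 f≡0 =
  cong₂ _+_ (f≡0 zero λ ()) (∑-delta (f ∘ suc) y fy≡1 (λ x x≢y → f≡0 (suc x) (x≢y ∘ FinP.suc-injective)))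

term≤∑ : ∀ {n} (f : Fin n → ℕ) i → f i ≤ sum f
term≤∑ f zero    = ℕP.m≤m+n _ _
term≤∑ f (suc i) = ℕP.≤-trans (term≤∑ (f ∘ suc) i) (ℕP.m≤n+m _ _)

two-terms≤∑ : ∀ {n} (f : Fin n → ℕ) i j → i ≢ j → f i + f j ≤ sum f
two-terms≤∑ f zero    zero    i≢j = ⊥-elim (i≢j refl)
two-terms≤∑ f zero    (suc j) _   = ℕP.+-monoʳ-≤ (f zero) (term≤∑ (f ∘ suc) j)
two-terms≤∑ f (suc i) zero    _   =
  subst (_≤ sum f) (ℕP.+-comm (f zero) (f (suc i))) (ℕP.+-monoʳ-≤ (f zero) (term≤∑ (f ∘ suc) i))
two-terms≤∑ f (suc i) (suc j) i≢j = ℕP.≤-trans (two-terms≤∑ (f ∘ suc) i j (i≢j ∘ cong suc)) (ℕP.m≤n+m _ _)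

module _ {k : ℕ} where

  multiplicity : ∀ {n} → Vec (Fin k) n → Fin k → ℕ
  multiplicity v x = Vec.count (_≟ x) v

  SingletonAt : ∀ {n} → Vec (Fin k) n → Fin n → Set
  SingletonAt v i = multiplicity v (lookup v i) ≡ 1

  lookup-ms : ∀ {n} (v : Vec (Fin k) n) x → lookup (ms v) x ≡ multiplicity v x
  lookup-ms v = VecP.lookup∘tabulate (multiplicity v)

  multiplicity-∙ : ∀ {n} (v : Vec (Fin k) n) (σ : Permutation′ n) x → multiplicity (v ∙ σ) x ≡ multiplicity v x
  multiplicity-∙ v σ x = count-∙ (_≟ x) v σ

  ms-∙ : ∀ {n} (v : Vec (Fin k) n) (σ : Permutation′ n) → ms (v ∙ σ) ≡ ms v
  ms-∙ v σ = VecP.tabulate-cong (multiplicity-∙ v σ)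

  ms-≗ : ∀ {n} (v : Vec (Fin k) n) {M : Vec ℕ k} → (∀ x → multiplicity v x ≡ lookup M x) → ms v ≡ M
  ms-≗ v {M} eq = trans (VecP.tabulate-cong eq) (VecP.tabulate∘lookup M)

  sum-ms : ∀ {n} (v : Vec (Fin k) n) → Vec.sum (ms v) ≡ n
  sum-ms {n} v = begin
    Vec.sum (ms v)                                     ≡⟨ Vec-sum-tabulate (multiplicity v) ⟩
    sum (multiplicity v)                               ≡⟨ sum-cong-≗ {k} (λ x → count≡∑indicator (_≟ x) v) ⟩
    sum (λ x → sum (λ i → indicator (lookup v i ≟ x))) ≡⟨ ∑-comm (λ x i → indicator (lookup v i ≟ x)) ⟩
    sum (λ i → sum (λ x → indicator (lookup v i ≟ x))) ≡⟨ ∑-one _ (λ i → ∑-indicator-≟ (lookup v i)) ⟩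
    n                                                  ∎
    where
    open ≡-Reasoning
    Vec-sum-tabulate : ∀ {m} (g : Fin m → ℕ) → Vec.sum (tabulate g) ≡ sum g
    Vec-sum-tabulate {zero}  g = refl
    Vec-sum-tabulate {suc m} g = cong (g zero +_) (Vec-sum-tabulate (g ∘ suc))
    ∑-indicator-≟ : (y : Fin k) → sum (λ x → indicator (y ≟ x)) ≡ 1
    ∑-indicator-≟ y = ∑-delta _ y (indicator-yes (y ≟ y) refl) (λ x x≢y → indicator-no (y ≟ x) (x≢y ∘ sym))

  singletonAt-unique : ∀ {n} (v : Vec (Fin k) n) {i j} → SingletonAt v i → lookup v j ≡ lookup v i → j ≡ i
  singletonAt-unique v {i} {j} single vj≡vi with j ≟ i
  ... | yes j≡i = j≡i
  ... | no  j≢i = ⊥-elim (ℕP.<-irrefl refl (subst (2 ≤_) (trans (sym (count≡∑indicator (_≟ x) v)) single) two≤))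
    where
    x = lookup v i
    f = λ p → indicator (lookup v p ≟ x)
    two≤ : 2 ≤ sum f
    two≤ = subst (_≤ sum f) (cong₂ _+_ (indicator-yes (lookup v j ≟ x) vj≡vi) (indicator-yes (x ≟ x) refl))
                 (two-terms≤∑ f j i j≢i)

  multiplicity-occurring : ∀ {n} (v : Vec (Fin k) n) i → 1 ≤ multiplicity v (lookup v i)
  multiplicity-occurring v i = subst (1 ≤_) (sym (count≡∑indicator (_≟ x) v))
    (subst (_≤ sum f) (indicator-yes (x ≟ x) refl) (term≤∑ f i))
    where
    x = lookup v i
    f = λ p → indicator (lookup v p ≟ x)

  sole-occurrence⇒singletonAt : ∀ {n} (v : Vec (Fin k) n) i → (∀ j → j ≢ i → lookup v j ≢ lookup v i) → SingletonAt v i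
  sole-occurrence⇒singletonAt v i sole = trans (count≡∑indicator (_≟ x) v)
    (∑-delta _ i (indicator-yes (x ≟ x) refl) (λ j j≢i → indicator-no (lookup v j ≟ x) (sole j j≢i)))
    where x = lookup v i

  multiplicity-absent : ∀ {n} (v : Vec (Fin k) n) x → (∀ j → lookup v j ≢ x) → multiplicity v x ≡ 0
  multiplicity-absent v x absent =
    trans (count≡∑indicator (_≟ x) v) (∑-zero _ (λ j → indicator-no (lookup v j ≟ x) (absent j)))

  multiplicity-∉ : ∀ {n} (v : Vec (Fin k) n) {x} → x ∉ toList v → multiplicity v x ≡ 0
  multiplicity-∉ []      x∉ = refl
  multiplicity-∉ (y ∷ v) {x} x∉ with y ≟ x
  ... | yes refl = ⊥-elim (x∉ (here refl))
  ... | no _     = multiplicity-∉ v (x∉ ∘ there)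

  multiplicity-∈-unique : ∀ {n} (v : Vec (Fin k) n) {x} → Unique (toList v) → x ∈ toList v → multiplicity v x ≡ 1
  multiplicity-∈-unique (y ∷ v) {x} (y∉v ∷ v!) x∈ with y ≟ x | x∈
  ... | yes refl | _         = cong suc (multiplicity-∉ v (λ x∈v → All.lookup y∉v x∈v refl))
  ... | no  y≢x  | here x≡y  = ⊥-elim (y≢x (sym x≡y))
  ... | no  _    | there x∈v = multiplicity-∈-unique v v! x∈v

⟨$⟩ʳ-injective : ∀ {m n} (σ : Permutation m n) → Injective _≡_ _≡_ (σ ⟨$⟩ʳ_)
⟨$⟩ʳ-injective σ eq = trans (sym (inverseˡ σ)) (trans (cong (σ ⟨$⟩ˡ_) eq) (inverseˡ σ))

strictlyIncreasing⇒injective : ∀ {ℓ n} {h : Fin ℓ → Fin n} → StrictlyIncreasing h → Injective _≡_ _≡_ h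
strictlyIncreasing⇒injective {h = h} inc {i} {j} hi≡hj with FinP.<-cmp i j
... | tri< i<j _ _ = ⊥-elim (FinP.<-irrefl hi≡hj (inc i j i<j))
... | tri≈ _ i≡j _ = i≡j
... | tri> _ _ j<i = ⊥-elim (FinP.<-irrefl (sym hi≡hj) (inc j i j<i))

injective-avoiding⇒< : ∀ {m n} {f : Fin m → Fin n} → Injective _≡_ _≡_ f →
  ∀ y → (∀ j → f j ≢ y) → m < n
injective-avoiding⇒< {n = suc n} {f} f-inj y avoids =
  s≤s (FinP.injective⇒≤ {f = λ j → Fin.punchOut (y≢f j)}
        (λ eq → f-inj (FinP.punchOut-injective (y≢f _) (y≢f _) eq)))
  where
  y≢f : ∀ j → y ≢ f j
  y≢f j = avoids j ∘ sym

injective-avoiding-two⇒< : ∀ {m n} {f : Fin m → Fin n} → Injective _≡_ _≡_ f →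
  ∀ x y → x ≢ y → (∀ j → f j ≢ x) → (∀ j → f j ≢ y) → suc m < n
injective-avoiding-two⇒< {m} {n} {f} f-inj x y x≢y avoids-x avoids-y =
  injective-avoiding⇒< g-inj y g-avoids-y
  where
  g : Fin (suc m) → Fin n
  g zero    = x
  g (suc j) = f j
  g-inj : Injective _≡_ _≡_ g
  g-inj {zero}  {zero}  _  = refl
  g-inj {zero}  {suc j} eq = ⊥-elim (avoids-x j (sym eq))
  g-inj {suc i} {zero}  eq = ⊥-elim (avoids-x i eq)
  g-inj {suc i} {suc j} eq = cong suc (f-inj eq)
  g-avoids-y : ∀ j → g j ≢ y
  g-avoids-y zero    = x≢y
  g-avoids-y (suc j) = avoids-y j

<⇒injective-avoids : ∀ {m n} {f : Fin m → Fin n} → m < n → Injective _≡_ _≡_ f →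
  ∃ λ y → ∀ j → f j ≢ y
<⇒injective-avoids {m} {n} {f} m<n f-inj
  with FinP.¬∀⟶∃¬ n (λ y → ∃ λ j → f j ≡ y) (λ y → FinP.any? (λ j → f j ≟ y)) surjective-impossible
  where
  surjective-impossible : ¬ (∀ y → ∃ λ j → f j ≡ y)
  surjective-impossible onto = ℕP.<⇒≱ m<n (FinP.injective⇒≤ {f = proj₁ ∘ onto}
    (λ {x} {y} eq → trans (sym (proj₂ (onto x))) (trans (cong f eq) (proj₂ (onto y)))))
... | y , unreached = y , λ j fj≡y → unreached (j , fj≡y)

transpose-sendsˡ : ∀ {n} (x y : Fin n) → PC.transpose x y x ≡ y
transpose-sendsˡ x y with x ≟ x
... | yes _   = refl
... | no  x≢x = ⊥-elim (x≢x refl)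

transpose-fixes : ∀ {n} (x y z : Fin n) → z ≢ x → z ≢ y → PC.transpose x y z ≡ z
transpose-fixes x y z z≢x z≢y with z ≟ x
... | yes z≡x = ⊥-elim (z≢x z≡x)
... | no _ with z ≟ y
...   | yes z≡y = ⊥-elim (z≢y z≡y)
...   | no _    = refl

injections-extend-to-permutation : ∀ {ℓ n} (g e : Fin ℓ → Fin n) → Injective _≡_ _≡_ g → Injective _≡_ _≡_ e →
  Σ[ ρ ∈ Permutation′ n ] (∀ j → ρ ⟨$⟩ʳ g j ≡ e j)
injections-extend-to-permutation {zero}  g e _ _ = Perm.id , λ ()
injections-extend-to-permutation {suc ℓ} g e g-inj e-inj
  with injections-extend-to-permutation (g ∘ suc) (e ∘ suc) (FinP.suc-injective ∘ g-inj) (FinP.suc-injective ∘ e-inj)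
... | ρ , ρg≗e = ρ ∘ₚ transpose (ρ ⟨$⟩ʳ g zero) (e zero) , extended
  where
  extended : ∀ j → PC.transpose (ρ ⟨$⟩ʳ g zero) (e zero) (ρ ⟨$⟩ʳ g j) ≡ e j
  extended zero    = transpose-sendsˡ (ρ ⟨$⟩ʳ g zero) (e zero)
  extended (suc j) = trans (cong (PC.transpose (ρ ⟨$⟩ʳ g zero) (e zero)) (ρg≗e j))
    (transpose-fixes _ _ (e (suc j))
      (λ eq → 0≢suc (g-inj (⟨$⟩ʳ-injective ρ (trans (sym eq) (sym (ρg≗e j))))))
      (λ eq → 0≢suc (e-inj (sym eq))))
    where
    0≢suc : zero ≢ suc j
    0≢suc ()

strictlySorted-≡ : ∀ {A : Set} {_<_ : Rel A 0ℓ} → Asymmetric _<_ → {xs ys : List A} →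
  AllPairs _<_ xs → AllPairs _<_ ys → (∀ {x} → x ∈ xs → x ∈ ys) → (∀ {x} → x ∈ ys → x ∈ xs) → xs ≡ ys
strictlySorted-≡ asym {[]}     {[]}     _ _ _ _ = refl
strictlySorted-≡ asym {[]}     {y ∷ _}  _ _ _ ys⊆xs with ys⊆xs (here refl)
... | ()
strictlySorted-≡ asym {x ∷ _}  {[]}     _ _ xs⊆ys _ with xs⊆ys (here refl)
... | ()
strictlySorted-≡ {_<_ = _<_} asym {x ∷ xs} {y ∷ ys} (x<xs ∷ xs↗) (y<ys ∷ ys↗) xs⊆ys ys⊆xs with heads-equal
  where
  heads-equal : x ≡ y
  heads-equal with xs⊆ys (here refl) | ys⊆xs (here refl)
  ... | here x≡y  | _         = x≡y
  ... | there _   | here y≡x  = sym y≡x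
  ... | there x∈ys | there y∈xs = ⊥-elim (asym (All.lookup x<xs y∈xs) (All.lookup y<ys x∈ys))
... | refl = cong (x ∷_) (strictlySorted-≡ asym xs↗ ys↗ (tail-⊆ x<xs y<ys xs⊆ys) (tail-⊆ y<ys x<xs ys⊆xs))
  where
  irrefl : ∀ {z} → ¬ (z < z)
  irrefl z<z = asym z<z z<z
  tail-⊆ : ∀ {us vs} → All.All (x <_) us → All.All (x <_) vs →
    (∀ {z} → z ∈ x ∷ us → z ∈ x ∷ vs) → ∀ {z} → z ∈ us → z ∈ vs
  tail-⊆ x<us x<vs us⊆vs z∈us with us⊆vs (there z∈us)
  ... | here refl = ⊥-elim (irrefl (All.lookup x<us z∈us))
  ... | there z∈vs = z∈vs

record Enumerates {ℓ n} (P : Fin n → Set) (h : Fin ℓ → Fin n) : Set where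
  field
    increasing : StrictlyIncreasing h
    sound      : ∀ j → P (h j)
    complete   : ∀ {i} → P i → ∃ λ j → h j ≡ i

module _ {n : ℕ} {P : Fin n → Set} where

  enumerate : Decidable P → Σ[ ℓ ∈ ℕ ] Σ[ h ∈ (Fin ℓ → Fin n) ] Enumerates P h
  enumerate P? = List.length ps , List.lookup ps , record
    { increasing = lookup-increasing (AllPairsP.filter⁺ P? (AllPairsP.tabulate⁺-< id))
    ; sound      = λ j → proj₂ (∈-filter⁻ P? {xs = List.allFin n} (∈-lookup j))
    ; complete   = λ Pi → let i∈ps = ∈-filter⁺ P? (∈-allFin _) Pi in Any.index i∈ps , sym (AnyP.lookup-index i∈ps)
    }
    where
    ps = List.filter P? (List.allFin n)
    lookup-increasing : ∀ {xs : List (Fin n)} → AllPairs Fin._<_ xs → StrictlyIncreasing (List.lookup xs)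
    lookup-increasing (x<xs ∷ _)  zero    (suc j) _   = All.lookup x<xs (∈-lookup j)
    lookup-increasing (_ ∷ xs↗) (suc i) (suc j) i<j = lookup-increasing xs↗ i j (ℕ.s<s⁻¹ i<j)

  filter-allFin-enumerated : ∀ {ℓ} {h : Fin ℓ → Fin n} (P? : Decidable P) → Enumerates P h →
    List.filter P? (List.allFin n) ≡ List.tabulate h
  filter-allFin-enumerated {h = h} P? E =
    strictlySorted-≡ FinP.<-asym (AllPairsP.filter⁺ P? (AllPairsP.tabulate⁺-< id))
      (AllPairsP.tabulate⁺-< (λ {i} {j} → increasing i j)) filtered⊆ ⊆filtered
    where
    open Enumerates E
    filtered⊆ : ∀ {x} → x ∈ List.filter P? (List.allFin n) → x ∈ List.tabulate h
    filtered⊆ x∈ with complete (proj₂ (∈-filter⁻ P? {xs = List.allFin n} x∈))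
    ... | j , refl = ∈-tabulate⁺ j
    ⊆filtered : ∀ {x} → x ∈ List.tabulate h → x ∈ List.filter P? (List.allFin n)
    ⊆filtered x∈ with ∈-tabulate⁻ x∈
    ... | j , refl = ∈-filter⁺ P? (∈-allFin (h j)) (sound j)

  Enumerates-resp : ∀ {ℓ} {Q : Fin n → Set} {h : Fin ℓ → Fin n} → P ≐ Q → Enumerates P h → Enumerates Q h
  Enumerates-resp (P⊆Q , Q⊆P) E = record
    { increasing = increasing ; sound = P⊆Q ∘ sound ; complete = complete ∘ Q⊆P }
    where open Enumerates E

  module _ (σ : Permutation′ n) where

    Enumerates-pattern : ∀ {ℓ} {h h′ : Fin ℓ → Fin n} (τ : Permutation′ ℓ) →
      StrictlyIncreasing h → (∀ i → σ ⟨$⟩ʳ h i ≡ h′ (τ ⟨$⟩ʳ i)) →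
      Enumerates P h′ → Enumerates (P ∘ (σ ⟨$⟩ʳ_)) h
    Enumerates-pattern {h = h} {h′} τ inc σh≗h′τ E = record
      { increasing = inc
      ; sound      = λ j → subst P (sym (σh≗h′τ j)) (sound (τ ⟨$⟩ʳ j))
      ; complete   = λ {i} Pσi → let j , h′j≡σi = complete Pσi in
          τ ⟨$⟩ˡ j , ⟨$⟩ʳ-injective σ (trans (σh≗h′τ _) (trans (cong h′ (inverseʳ τ)) h′j≡σi))
      }
      where open Enumerates E

    pattern-of-enumerations : ∀ {ℓ m} {h : Fin m → Fin n} {h′ : Fin ℓ → Fin n} →
      Enumerates (P ∘ (σ ⟨$⟩ʳ_)) h → Enumerates P h′ →
      Σ[ τ ∈ Permutation m ℓ ] (∀ i → σ ⟨$⟩ʳ h i ≡ h′ (τ ⟨$⟩ʳ i))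
    pattern-of-enumerations {h = h} {h′} E E′ = τ , λ i → sym (proj₂ (forth i))
      where
      module E = Enumerates E
      module E′ = Enumerates E′
      forth : ∀ i → ∃ λ j → h′ j ≡ σ ⟨$⟩ʳ h i
      forth i = E′.complete (E.sound i)
      back : ∀ j → ∃ λ i → h i ≡ σ ⟨$⟩ˡ h′ j
      back j = E.complete (subst P (sym (inverseʳ σ)) (E′.sound j))
      τ : Permutation _ _
      τ = permutation (proj₁ ∘ forth) (proj₁ ∘ back)
        (λ j → strictlyIncreasing⇒injective E′.increasing
                 (trans (proj₂ (forth _)) (trans (cong (σ ⟨$⟩ʳ_) (proj₂ (back j))) (inverseʳ σ))))
        (λ i → strictlyIncreasing⇒injective E.increasing
                 (trans (proj₂ (back _)) (trans (cong (σ ⟨$⟩ˡ_) (proj₂ (forth i))) (inverseˡ σ))))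

filter-map : ∀ {A B : Set} {P : B → Set} (P? : Decidable P) (f : A → B) (xs : List A) →
  List.filter P? (List.map f xs) ≡ List.map f (List.filter (P? ∘ f) xs)
filter-map P? f []       = refl
filter-map P? f (x ∷ xs) with P? (f x)
... | yes _ = cong (f x ∷_) (filter-map P? f xs)
... | no _  = filter-map P? f xs

toList-tabulate : ∀ {A : Set} {n} (f : Fin n → A) → toList (tabulate f) ≡ List.tabulate f
toList-tabulate {n = zero}  f = refl
toList-tabulate {n = suc n} f = cong (f zero ∷_) (toList-tabulate (f ∘ suc))

toList≡tabulate-lookup : ∀ {A : Set} {n} (v : Vec A n) → toList v ≡ List.tabulate (lookup v)
toList≡tabulate-lookup v = trans (cong toList (sym (VecP.tabulate∘lookup v))) (toList-tabulate (lookup v))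

module _ {k n : ℕ} where

  singletonAt? : (v : Vec (Fin k) n) → Decidable (SingletonAt v)
  singletonAt? v i = multiplicity v (lookup v i) ℕ.≟ 1

  singletonAt-∙ : (v : Vec (Fin k) n) (σ : Permutation′ n) → SingletonAt (v ∙ σ) ≐ SingletonAt v ∘ (σ ⟨$⟩ʳ_)
  singletonAt-∙ v σ = subst (_≡ 1) moved , subst (_≡ 1) (sym moved)
    where
    moved : ∀ {i} → multiplicity (v ∙ σ) (lookup (v ∙ σ) i) ≡ multiplicity v (lookup v (σ ⟨$⟩ʳ i))
    moved {i} = trans (multiplicity-∙ v σ _) (cong (multiplicity v) (VecP.lookup∘tabulate _ i))

  singles-enumerated : ∀ {ℓ} (v : Vec (Fin k) n) {h : Fin ℓ → Fin n} (a : Vec (Fin k) ℓ) →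
    Enumerates (SingletonAt v) h → (∀ j → lookup v (h j) ≡ lookup a j) → singles v ≡ toList a
  singles-enumerated v {h} a E v∘h≗a = begin
    singles v
      ≡⟨ cong (List.filter _) (toList≡tabulate-lookup v) ⟩
    List.filter _ (List.tabulate (lookup v))
      ≡⟨ cong (List.filter _) (ListP.map-tabulate id (lookup v)) ⟨
    List.filter _ (List.map (lookup v) (List.allFin n))
      ≡⟨ filter-map (λ x → multiplicity v x ℕ.≟ 1) (lookup v) (List.allFin n) ⟩
    List.map (lookup v) (List.filter (singletonAt? v) (List.allFin n))
      ≡⟨ cong (List.map (lookup v)) (filter-allFin-enumerated (singletonAt? v) E) ⟩
    List.map (lookup v) (List.tabulate h)
      ≡⟨ ListP.map-tabulate h (lookup v) ⟩
    List.tabulate (lookup v ∘ h)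
      ≡⟨ ListP.tabulate-cong v∘h≗a ⟩
    List.tabulate (lookup a)
      ≡⟨ toList≡tabulate-lookup a ⟨
    toList a
      ∎
    where open ≡-Reasoning

  singles-∙-pattern : ∀ {ℓ} (b : Vec (Fin k) n) (σ : Permutation′ n) (τ : Permutation′ ℓ) {h h′ : Fin ℓ → Fin n}
    (a : Vec (Fin k) ℓ) → Enumerates (SingletonAt b) h′ → StrictlyIncreasing h →
    (∀ i → σ ⟨$⟩ʳ h i ≡ h′ (τ ⟨$⟩ʳ i)) → (∀ j → lookup b (h′ j) ≡ lookup a j) →
    singles (b ∙ σ) ≡ toList (a ∙ τ)
  singles-∙-pattern b σ τ {h} {h′} a E inc σh≗h′τ b∘h′≗a =
    singles-enumerated (b ∙ σ) (a ∙ τ) E∙σ bσ∘h≗aτ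
    where
    E∙σ : Enumerates (SingletonAt (b ∙ σ)) h
    E∙σ = Enumerates-resp (swap (singletonAt-∙ b σ)) (Enumerates-pattern σ τ inc σh≗h′τ E)
    bσ∘h≗aτ : ∀ i → lookup (b ∙ σ) (h i) ≡ lookup (a ∙ τ) i
    bσ∘h≗aτ i = begin
      lookup (b ∙ σ) (h i)       ≡⟨ VecP.lookup∘tabulate _ (h i) ⟩
      lookup b (σ ⟨$⟩ʳ h i)      ≡⟨ cong (lookup b) (σh≗h′τ i) ⟩
      lookup b (h′ (τ ⟨$⟩ʳ i))   ≡⟨ b∘h′≗a (τ ⟨$⟩ʳ i) ⟩
      lookup a (τ ⟨$⟩ʳ i)        ≡⟨ VecP.lookup∘tabulate _ i ⟨
      lookup (a ∙ τ) i           ∎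
      where open ≡-Reasoning

module SingletonEnumeration {k n : ℕ} (b : Vec (Fin k) n) {ℓ} {h : Fin ℓ → Fin n}
                            (E : Enumerates (SingletonAt b) h) where

  open Enumerates E

  singletons : Vec (Fin k) ℓ
  singletons = tabulate (lookup b ∘ h)

  h-injective : Injective _≡_ _≡_ h
  h-injective = strictlyIncreasing⇒injective increasing

  singletons-injective : Injective _≡_ _≡_ (lookup b ∘ h)
  singletons-injective eq = h-injective (sym (singletonAt-unique b (sound _) (sym eq)))

  unenumerated-letter : ∀ {i} → (∀ j → h j ≢ i) → ∀ j → lookup b (h j) ≢ lookup b i
  unenumerated-letter avoids j eq = avoids j (sym (singletonAt-unique b (sound j) (sym eq)))

  unenumerated⇒¬singletonAt : ∀ {i} → (∀ j → h j ≢ i) → ¬ SingletonAt b i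
  unenumerated⇒¬singletonAt avoids single = let j , hj≡i = complete single in avoids j hj≡i

  -- If k < n, some position is not a singleton position, and its letter is none of the ℓ singleton
  -- letters, so ℓ < k.  If ℓ = n - 1, the single remaining position would carry a letter occurring once.
  singleton-count∈Z : 1 ≤ n → InZ k n ℓ
  singleton-count∈Z 1≤n with k ℕ.<? n
  ... | yes k<n = inj₁ (k<n , ℓ<k)
    where
    ℓ<n : ℓ < n
    ℓ<n = ℕP.≤-<-trans (FinP.injective⇒≤ singletons-injective) k<n
    ℓ<k : ℓ < k
    ℓ<k = let i , avoids = <⇒injective-avoids ℓ<n h-injective in
      injective-avoiding⇒< singletons-injective (lookup b i) (unenumerated-letter avoids)
  ... | no k≮n = inj₂ (ℕP.≮⇒≥ k≮n , FinP.injective⇒≤ h-injective , ℓ≢n∸1)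
    where
    ℓ≢n∸1 : ℓ ≢ n ∸ 1
    ℓ≢n∸1 ℓ≡n∸1 = unenumerated⇒¬singletonAt avoids-i (sole-occurrence⇒singletonAt b i sole)
      where
      1+ℓ≡n : suc ℓ ≡ n
      1+ℓ≡n = trans (cong suc ℓ≡n∸1) (ℕP.m+[n∸m]≡n 1≤n)
      i-avoided = <⇒injective-avoids (subst (ℓ <_) 1+ℓ≡n (ℕP.n<1+n ℓ)) h-injective
      i = proj₁ i-avoided
      avoids-i = proj₂ i-avoided
      sole : ∀ j → j ≢ i → lookup b j ≢ lookup b i
      sole j j≢i bj≡bi = ℕP.<-irrefl 1+ℓ≡n
        (injective-avoiding-two⇒< h-injective i j (j≢i ∘ sym) avoids-i avoids-j)
        where
        avoids-j : ∀ j′ → h j′ ≢ j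
        avoids-j j′ refl = unenumerated-letter avoids-i j′ bj≡bi

  cs∈Z : IsZ n (ms b) (toList singletons)
  cs∈Z = sum-ms b , unique , λ x → singleton⇒multiplicity-one x , multiplicity-one⇒singleton x
    where
    toList-singletons : toList singletons ≡ List.tabulate (lookup b ∘ h)
    toList-singletons = toList-tabulate (lookup b ∘ h)
    unique : Unique (toList singletons)
    unique = subst Unique (sym toList-singletons) (UniqueP.tabulate⁺ singletons-injective)
    singleton⇒multiplicity-one : ∀ x → x ∈ toList singletons → lookup (ms b) x ≡ 1
    singleton⇒multiplicity-one x x∈ with ∈-tabulate⁻ (subst (x ∈_) toList-singletons x∈)
    ... | j , refl = trans (lookup-ms b _) (sound j)
    multiplicity-one⇒singleton : ∀ x → lookup (ms b) x ≡ 1 → x ∈ toList singletons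
    multiplicity-one⇒singleton x one with FinP.any? (λ i → lookup b i ≟ x)
    ... | no absent = ⊥-elim (ℕP.0≢1+n (trans (sym (multiplicity-absent b x (λ i eq → absent (i , eq))))
                                              (trans (sym (lookup-ms b x)) one)))
    ... | yes (i , refl) with complete (trans (sym (lookup-ms b _)) one)
    ...   | j , refl = subst (_ ∈_) (sym toList-singletons) (∈-tabulate⁺ j)

module _ {k n : ℕ} {B : Set} (F G : Vec ℕ k → List (Fin k) → B) (σ : Permutation′ n) where

  patterns-transfer-to-cs : 1 ≤ n →
    ((ℓ : ℕ) → InZ k n ℓ → (τ : Permutation′ ℓ) → IsPattern σ τ →
      (M : Vec ℕ k) (a : Vec (Fin k) ℓ) → IsZ n M (toList a) → G M (toList a) ≡ F M (toList (a ∙ τ))) →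
    (b : Vec (Fin k) n) → (G ∘cs) b ≡ (F ∘cs) (b ∙ σ)
  patterns-transfer-to-cs 1≤n patternwise b
    with enumerate (singletonAt? b) | enumerate (singletonAt? (b ∙ σ))
  ... | ℓ , h′ , E′ | _ , h , E
    with pattern-of-enumerations σ (Enumerates-resp (singletonAt-∙ b σ) E) E′
  ... | τ , σh≗h′τ with ↔⇒≡ τ
  ... | refl = begin
    G (ms b) (singles b)                ≡⟨ cong (G (ms b)) (singles-enumerated b a E′ b∘h′≗a) ⟩
    G (ms b) (toList a)                 ≡⟨ patternwise ℓ (singleton-count∈Z 1≤n) τ τ-pattern (ms b) a cs∈Z ⟩
    F (ms b) (toList (a ∙ τ))           ≡⟨ cong₂ F (ms-∙ b σ) singles-bσ ⟨
    F (ms (b ∙ σ)) (singles (b ∙ σ))    ∎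
    where
    open ≡-Reasoning
    open SingletonEnumeration b E′ renaming (singletons to a)
    τ-pattern : IsPattern σ τ
    τ-pattern = h , h′ , Enumerates.increasing E , Enumerates.increasing E′ , σh≗h′τ
    b∘h′≗a : ∀ j → lookup b (h′ j) ≡ lookup a j
    b∘h′≗a j = sym (VecP.lookup∘tabulate _ j)
    singles-bσ : singles (b ∙ σ) ≡ toList (a ∙ τ)
    singles-bσ = singles-∙-pattern b σ τ a E′ (Enumerates.increasing E) σh≗h′τ b∘h′≗a

module _ {k : ℕ} where

  multiplicity-replicate-same : ∀ m (x : Fin k) → multiplicity (Vec.replicate m x) x ≡ m
  multiplicity-replicate-same zero    x = refl
  multiplicity-replicate-same (suc m) x with x ≟ x
  ... | yes _   = cong suc (multiplicity-replicate-same m x)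
  ... | no  x≢x = ⊥-elim (x≢x refl)

  multiplicity-replicate-other : ∀ m {x y : Fin k} → y ≢ x → multiplicity (Vec.replicate m y) x ≡ 0
  multiplicity-replicate-other zero    y≢x = refl
  multiplicity-replicate-other (suc m) {x} {y} y≢x with y ≟ x
  ... | yes y≡x = ⊥-elim (y≢x y≡x)
  ... | no _    = multiplicity-replicate-other m y≢x

  multiplicity-map-suc-zero : ∀ {n} (v : Vec (Fin k) n) → multiplicity (Vec.map suc v) zero ≡ 0
  multiplicity-map-suc-zero []      = refl
  multiplicity-map-suc-zero (_ ∷ v) = multiplicity-map-suc-zero v

  multiplicity-map-suc : ∀ {n} (v : Vec (Fin k) n) x → multiplicity (Vec.map suc v) (suc x) ≡ multiplicity v x
  multiplicity-map-suc []      x = refl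
  multiplicity-map-suc (y ∷ v) x with y ≟ x
  ... | yes _ = cong suc (multiplicity-map-suc v x)
  ... | no _  = multiplicity-map-suc v x

realise : ∀ {k} (M : Vec ℕ k) → Vec (Fin k) (Vec.sum M)
realise []      = []
realise (m ∷ M) = Vec.replicate m zero ++ Vec.map suc (realise M)

multiplicity-realise : ∀ {k} (M : Vec ℕ k) x → multiplicity (realise M) x ≡ lookup M x
multiplicity-realise (m ∷ M) x = begin
  multiplicity (Vec.replicate m zero ++ Vec.map suc (realise M)) x
    ≡⟨ count-++ (_≟ x) (Vec.replicate m zero) _ ⟩
  multiplicity (Vec.replicate m zero) x + multiplicity (Vec.map suc (realise M)) x
    ≡⟨ split x ⟩
  lookup (m ∷ M) x
    ∎
  where
  open ≡-Reasoning
  split : ∀ y → multiplicity (Vec.replicate m zero) y + multiplicity (Vec.map suc (realise M)) y ≡ lookup (m ∷ M) y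
  split zero    = trans (cong₂ _+_ (multiplicity-replicate-same m zero) (multiplicity-map-suc-zero (realise M)))
                        (ℕP.+-identityʳ m)
  split (suc y) = trans (cong₂ _+_ (multiplicity-replicate-other m λ ()) (multiplicity-map-suc (realise M) y))
                        (multiplicity-realise M y)

module _ {k ℓ r : ℕ} {M : Vec ℕ k} (a : Vec (Fin k) ℓ) (R : Vec (Fin k) r)
         (a-singletons : ∀ j → lookup M (lookup a j) ≡ 1)
         (R-non-singletons : ∀ q → lookup M (lookup R q) ≢ 1)
         (content : ∀ x → multiplicity (a ++ R) x ≡ lookup M x) where

  place-singletons : ∀ {h′ : Fin ℓ → Fin (ℓ + r)} → StrictlyIncreasing h′ →
    Σ[ b ∈ Vec (Fin k) (ℓ + r) ] ms b ≡ M × (∀ j → lookup b (h′ j) ≡ lookup a j) × Enumerates (SingletonAt b) h′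
  place-singletons {h′} inc = b , ms-≗ b b-content , b∘h′≗a , record
    { increasing = inc
    ; sound      = λ j → trans (b-content _) (trans (cong (lookup M) (b∘h′≗a j)) (a-singletons j))
    ; complete   = λ single → enumerated _ (trans (sym (b-content _)) single)
    }
    where
    ρ,ρh′≗↑ˡ = injections-extend-to-permutation h′ (_↑ˡ r) (strictlyIncreasing⇒injective inc) (FinP.↑ˡ-injective r _ _)
    ρ = proj₁ ρ,ρh′≗↑ˡ
    b = (a ++ R) ∙ ρ
    b-content : ∀ x → multiplicity b x ≡ lookup M x
    b-content x = trans (multiplicity-∙ (a ++ R) ρ x) (content x)
    lookup-b : ∀ i → lookup b i ≡ lookup (a ++ R) (ρ ⟨$⟩ʳ i)
    lookup-b = VecP.lookup∘tabulate _
    b∘h′≗a : ∀ j → lookup b (h′ j) ≡ lookup a j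
    b∘h′≗a j = trans (lookup-b (h′ j)) (trans (cong (lookup (a ++ R)) (proj₂ ρ,ρh′≗↑ˡ j)) (VecP.lookup-++ˡ a R j))
    enumerated : ∀ i → lookup M (lookup b i) ≡ 1 → ∃ λ j → h′ j ≡ i
    enumerated i single with Fin.splitAt ℓ (ρ ⟨$⟩ʳ i) in split
    ... | inj₁ j = j , ⟨$⟩ʳ-injective ρ (trans (proj₂ ρ,ρh′≗↑ˡ j) (FinP.splitAt⁻¹-↑ˡ split))
    ... | inj₂ q = ⊥-elim (R-non-singletons q (trans (cong (lookup M) R-at-i) single))
      where
      R-at-i : lookup R q ≡ lookup b i
      R-at-i = sym (trans (lookup-b i) (trans (cong (lookup (a ++ R)) (sym (FinP.splitAt⁻¹-↑ʳ split))) (VecP.lookup-++ʳ a R q)))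

dropOne : ℕ → ℕ
dropOne 1 = 0
dropOne m = m

indicator-+-dropOne : ∀ m → indicator (m ℕ.≟ 1) + dropOne m ≡ m
indicator-+-dropOne 0             = refl
indicator-+-dropOne 1             = refl
indicator-+-dropOne (suc (suc m)) = refl

positive-dropOne⇒≢1 : ∀ {m} → 1 ≤ dropOne m → m ≢ 1
positive-dropOne⇒≢1 () refl

-- The filler lists every letter of multiplicity m ≠ 1 exactly m times, so a ++ filler has content M.
realisation : ∀ {k n ℓ} {M : Vec ℕ k} {a : Vec (Fin k) ℓ} {h′ : Fin ℓ → Fin n} →
  IsZ n M (toList a) → StrictlyIncreasing h′ →
  Σ[ b ∈ Vec (Fin k) n ] ms b ≡ M × (∀ j → lookup b (h′ j) ≡ lookup a j) × Enumerates (SingletonAt b) h′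
realisation {k} {n} {ℓ} {M} {a} (sum≡n , unique , singleton⇔one) =
  place-at-length (trans (sym (sum-ms (a ++ filler))) (trans (cong Vec.sum (ms-≗ (a ++ filler) {M} content)) sum≡n))
  where
  filler : Vec (Fin k) (Vec.sum (Vec.map dropOne M))
  filler = realise (Vec.map dropOne M)
  multiplicity-filler : ∀ x → multiplicity filler x ≡ dropOne (lookup M x)
  multiplicity-filler x = trans (multiplicity-realise (Vec.map dropOne M) x) (VecP.lookup-map x dropOne M)
  multiplicity-a : ∀ x → multiplicity a x ≡ indicator (lookup M x ℕ.≟ 1)
  multiplicity-a x with lookup M x ℕ.≟ 1
  ... | yes one = multiplicity-∈-unique a unique (proj₂ (singleton⇔one x) one)
  ... | no ¬one = multiplicity-∉ a (¬one ∘ proj₁ (singleton⇔one x))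
  content : ∀ x → multiplicity (a ++ filler) x ≡ lookup M x
  content x = trans (count-++ (_≟ x) a filler)
    (trans (cong₂ _+_ (multiplicity-a x) (multiplicity-filler x)) (indicator-+-dropOne (lookup M x)))
  a-singletons : ∀ j → lookup M (lookup a j) ≡ 1
  a-singletons j = proj₁ (singleton⇔one (lookup a j)) (subst (lookup a j ∈_) (sym (toList≡tabulate-lookup a)) (∈-tabulate⁺ j))
  filler-non-singletons : ∀ q → lookup M (lookup filler q) ≢ 1
  filler-non-singletons q = positive-dropOne⇒≢1 (subst (1 ≤_) (multiplicity-filler _) (multiplicity-occurring filler q))
  place-at-length : ∀ {h′ : Fin ℓ → Fin n} → ℓ + Vec.sum (Vec.map dropOne M) ≡ n → StrictlyIncreasing h′ →
    Σ[ b ∈ Vec (Fin k) n ] ms b ≡ M × (∀ j → lookup b (h′ j) ≡ lookup a j) × Enumerates (SingletonAt b) h′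
  place-at-length refl = place-singletons a filler a-singletons filler-non-singletons content

module _ {k n : ℕ} {B : Set} (F G : Vec ℕ k → List (Fin k) → B) (σ : Permutation′ n) where

  cs-transfer-to-patterns : ((b : Vec (Fin k) n) → (G ∘cs) b ≡ (F ∘cs) (b ∙ σ)) →
    ∀ {ℓ} (τ : Permutation′ ℓ) → IsPattern σ τ →
    (M : Vec ℕ k) (a : Vec (Fin k) ℓ) → IsZ n M (toList a) → G M (toList a) ≡ F M (toList (a ∙ τ))
  cs-transfer-to-patterns csWise τ (h , h′ , inc , inc′ , σh≗h′τ) M a isZ
    with realisation isZ inc′
  ... | b , msb≡M , b∘h′≗a , E = begin
    G M (toList a)                      ≡⟨ cong₂ G msb≡M (singles-enumerated b a E b∘h′≗a) ⟨
    G (ms b) (singles b)                ≡⟨ csWise b ⟩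
    F (ms (b ∙ σ)) (singles (b ∙ σ))    ≡⟨ cong₂ F (trans (ms-∙ b σ) msb≡M) singles-bσ ⟩
    F M (toList (a ∙ τ))                ∎
    where
    open ≡-Reasoning
    singles-bσ : singles (b ∙ σ) ≡ toList (a ∙ τ)
    singles-bσ = singles-∙-pattern b σ τ a E inc σh≗h′τ b∘h′≗a

lemma5p6 : (k n : ℕ) (B : Set) → B → 1 ≤ n →
    (F G : Vec ℕ k → List (Fin k) → B) (σ : Permutation′ n) →
    (((b : Vec (Fin k) n) → (G ∘cs) b ≡ (F ∘cs) (b ∙ σ)) ⇔
      ((ℓ : ℕ) → InZ k n ℓ → (τ : Permutation′ ℓ) → IsPattern σ τ →
        (M : Vec ℕ k) (a : Vec (Fin k) ℓ) → IsZ n M (toList a) →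
        G M (toList a) ≡ F M (toList (a ∙ τ))))
    × (Inv (F ∘cs) σ ⇔
      ((ℓ : ℕ) → InZ k n ℓ → (τ : Permutation′ ℓ) → IsPattern σ τ → InvStar n ℓ F τ))
    × ((π : Permutation′ n) →
      Inv (F ∘cs) π ⇔ ((ℓ : ℕ) → InZ k n ℓ → Comp n (InvStar n ℓ F) π))
lemma5p6 k n B _ 1≤n F G σ =
  mk⇔ (λ csWise ℓ _ → cs-transfer-to-patterns F G σ csWise) (patterns-transfer-to-cs F G σ 1≤n) ,
  Inv⇔patternwise σ ,
  Inv⇔patternwise
  where
  Inv⇔patternwise : (π : Permutation′ n) → Inv (F ∘cs) π ⇔ ((ℓ : ℕ) → InZ k n ℓ → Comp n (InvStar n ℓ F) π)
  Inv⇔patternwise π = mk⇔ (λ inv ℓ _ → cs-transfer-to-patterns F F π (sym ∘ inv))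
                          (λ patternwise b → sym (patterns-transfer-to-cs F F π 1≤n patternwise b))
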